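{- Let $\mathcal G$ be a semifilter on $\omega$ that is a $G_\delta$ subset of $2^\omega$ and has the Ramsey property. Then $\mathcal G$ is countably Ramsey.
   Context: For $A,B\subseteq\omega$, $A\subseteq^* B$ means $A\setminus B$ is finite. A semifilter on $\omega$ is a set $\mathcal S\subseteq\mathcal P(\omega)$ with $\emptyset\neq\mathcal S\neq\mathcal P(\omega)$ closed upwards under $\subseteq^*$; subsets of $\omega$ are identified with points of $2^\omega$. $\mathcal S$ has the Ramsey property if whenever $A\in\mathcal S$ and $A=\bigcup_{i\le n}A_i$, some $A_i\in\mathcal S$. $\mathcal S$ is countably Ramsey if whenever $A\in\mathcal S$ and $A=\bigcup_{n\in\omega}A_n$, either $A_n\in\mathcal S$ for some $n$, or there is $B\subseteq A$ with $B\in\mathcal S$ and $B\cap A_n$ finite for every $n$. -}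

module Defs where

open import Data.Nat using (ℕ; zero; suc; _≤_)
open import Data.Bool using (Bool; true; false)
open import Data.Fin using (Fin)
open import Data.List using (List; []; _∷_)
open import Data.Product using (Σ; ∃; _×_; _,_)
open import Data.Sum using (_⊎_)
open import Data.Empty using (⊥)
open import Relation.Nullary using (¬_)
open import Relation.Binary.PropositionalEquality using (_≡_)
open import Function.Bundles using (_⇔_)

-- A subset of ω, identified with a point of 2^ω.
Subset : Set
Subset = ℕ → Bool

_∈_ : ℕ → Subset → Set
n ∈ A = A n ≡ true

_⊆_ : Subset → Subset → Set
A ⊆ B = ∀ n → n ∈ A → n ∈ B

_⊆*_ : Subset → Subset → Set
A ⊆* B = ∃ λ N → ∀ n → N ≤ n → n ∈ A → n ∈ B

FiniteIntersection : Subset → Subset → Set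
FiniteIntersection A B = ∃ λ N → ∀ n → N ≤ n → n ∈ A → n ∈ B → ⊥

IsUnion : {I : Set} → Subset → (I → Subset) → Set
IsUnion {I} A As = ∀ n → (n ∈ A) ⇔ (∃ λ (i : I) → n ∈ As i)

Family : Set₁
Family = Subset → Set

record IsSemifilter (S : Family) : Set₁ where
  field
    nonempty   : ∃ λ A → S A
    notAll     : ∃ λ A → ¬ S A
    upClosed*  : ∀ A B → S A → A ⊆* B → S B

RamseyProperty : Family → Set
RamseyProperty S =
  ∀ (n : ℕ) (A : Subset) (As : Fin (suc n) → Subset) →
  S A → IsUnion A As → ∃ λ i → S (As i)

CountablyRamsey : Family → Set
CountablyRamsey S =
  ∀ (A : Subset) (As : ℕ → Subset) → S A → IsUnion A As →
  (∃ λ n → S (As n)) ⊎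
  (∃ λ B → B ⊆ A × S B × (∀ n → FiniteIntersection B (As n)))

prefix : Subset → ℕ → List Bool
prefix x zero = []
prefix x (suc k) = x zero ∷ prefix (λ n → x (suc n)) k

-- Open subset of 2^ω given by a set W of finite strings: ⋃_{s ∈ W} [s]
InOpen : (List Bool → Set) → Subset → Set
InOpen W x = ∃ λ k → W (prefix x k)

IsGδ : Family → Set₁
IsGδ S = ∃ λ (U : ℕ → List Bool → Set) → ∀ x → S x ⇔ (∀ n → InOpen (U n) x)

module Submission where

-- Let A ∈ G with A = ⋃ₙ Aₙ and suppose no Aₙ lies in G (the
-- dichotomy is decided by excluded middle).  Write Restₖ = A ∖ (A₀ ∪ … ∪ Aₖ₋₁).
-- Since A = Restₖ ∪ A₀ ∪ … ∪ Aₖ₋₁, the Ramsey property puts every Restₖ in G.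
-- The G_δ hypothesis G = ⋂ₖ Uₖ then lets us "fuse" the sets Restₖ into one set
-- B ∈ G: stage k is a member Qₖ of G; a finite prefix of Qₖ already witnesses
-- Qₖ ∈ Uₖ, and stage k+1 keeps Qₖ below a bound beyond that prefix and
-- continues with Restₖ₊₁ (a finite modification, so still in G).  The limit B
-- agrees with each Qₖ on its witnessing prefix, hence B ∈ ⋂ₖ Uₖ = G; and every
-- point of B comes from some Restⱼ, from some Restⱼ with j > n beyond a bound,
-- so B ⊆ A and B ∩ Aₙ is finite.

open import Defs
open import Level using (0ℓ)
open import Axiom.ExcludedMiddle using (ExcludedMiddle)
open import Data.Nat using (ℕ; zero; suc; _≤_; _<_; z≤n; s≤s; _⊔_; _<?_; _≤?_)
open import Data.Nat.Properties
  using (≤-refl; ≤-trans; <-≤-trans; ≤-<-trans; n≤1+n; m≤m⊔n; m≤n⊔m; m≤n⇒m<n∨m≡n; ≰⇒>; <⇒≱; <⇒≤)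
open import Data.Bool using (Bool; true; false)
open import Data.Fin using (Fin; toℕ; fromℕ<) renaming (zero to fzero; suc to fsuc)
open import Data.Fin.Properties using (toℕ-fromℕ<)
open import Data.List using (List; _∷_)
open import Data.Product using (∃; _×_; _,_; proj₁; proj₂)
open import Data.Sum using (_⊎_; inj₁; inj₂)
open import Data.Empty using (⊥-elim)
open import Relation.Nullary using (¬_; yes; no; contradiction)
open import Relation.Binary.PropositionalEquality using (_≡_; refl; sym; trans; cong₂; subst)
open import Function.Bundles using (_⇔_; mk⇔; Equivalence)

-- `splice m f g` follows f below m and g from m on; it is how a stage of the
-- fusion construction freezes a finite initial segment.
splice : ℕ → Subset → Subset → Subset
splice m f g x with x <? m
... | yes _ = f x
... | no _ = g x

splice-below : ∀ m f g x → x < m → splice m f g x ≡ f x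
splice-below m f g x x<m with x <? m
... | yes _ = refl
... | no x≮m = contradiction x<m x≮m

splice-above : ∀ m f g x → m ≤ x → splice m f g x ≡ g x
splice-above m f g x m≤x with x <? m
... | yes x<m = contradiction m≤x (<⇒≱ x<m)
... | no _ = refl

prefix-cong : ∀ (f g : Subset) ℓ → (∀ x → x < ℓ → f x ≡ g x) → prefix f ℓ ≡ prefix g ℓ
prefix-cong f g zero agree = refl
prefix-cong f g (suc ℓ) agree =
  cong₂ _∷_ (agree 0 (s≤s z≤n))
            (prefix-cong (λ n → f (suc n)) (λ n → g (suc n)) ℓ (λ x x<ℓ → agree (suc x) (s≤s x<ℓ)))

-- A semifilter is closed under finite modification: splicing only changes
-- finitely many bits of its second argument.
splice-member : ∀ {S} → IsSemifilter S → ∀ m f g → S g → S (splice m f g)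
splice-member SF m f g g∈S =
  IsSemifilter.upClosed* SF g (splice m f g) g∈S (m , λ x m≤x x∈g → trans (splice-above m f g x m≤x) x∈g)

record Assembled (D : ℕ → Subset) : Set where
  field
    set      : Subset
    from     : ∀ x → ∃ λ j → set x ≡ D j x
    tailFrom : ∀ k → ∃ λ N → ∀ x → N ≤ x → ∃ λ j → k ≤ j × set x ≡ D j x

module Fusion (S : Family) (U : ℕ → List Bool → Set)
  (S⇔U : ∀ x → S x ⇔ (∀ k → InOpen (U k) x))
  (modify : ∀ m f g → S g → S (splice m f g))
  (D : ℕ → Subset) (D∈S : ∀ k → S (D k)) where

  -- A stage of the construction: a member of S together with the bound below
  -- which it is frozen for all later stages.
  record Stage : Set where
    field
      bound  : ℕ
      set    : Subset
      member : S set
  open Stage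

  window : ℕ → Stage → ℕ
  window k s = proj₁ (Equivalence.to (S⇔U (set s)) (member s) k)

  next : ℕ → Stage → Stage
  next k s = record
    { bound  = m
    ; set    = splice m (set s) (D (suc k))
    ; member = modify m (set s) (D (suc k)) (D∈S (suc k))
    }
    where m = suc (bound s ⊔ window k s)

  stage : ℕ → Stage
  stage zero = record { bound = 0 ; set = D 0 ; member = D∈S 0 }
  stage (suc k) = next k (stage k)

  M : ℕ → ℕ
  M k = bound (stage k)

  Q : ℕ → Subset
  Q k = set (stage k)

  L : ℕ → ℕ
  L k = window k (stage k)

  L<M : ∀ k → L k < M (suc k)
  L<M k = s≤s (m≤n⊔m (M k) (L k))

  M-step : ∀ k → M k ≤ M (suc k)
  M-step k = ≤-trans (m≤m⊔n (M k) (L k)) (n≤1+n _)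

  M-mono : ∀ {k k'} → k ≤ k' → M k ≤ M k'
  M-mono {k} {zero} z≤n = ≤-refl
  M-mono {k} {suc k'} k≤ with m≤n⇒m<n∨m≡n k≤
  ... | inj₁ (s≤s k≤k') = ≤-trans (M-mono k≤k') (M-step k')
  ... | inj₂ refl = ≤-refl

  k≤M : ∀ k → k ≤ M k
  k≤M zero = z≤n
  k≤M (suc k) = s≤s (≤-trans (k≤M k) (m≤m⊔n (M k) (L k)))

  Q-suc-below : ∀ k x → x < M (suc k) → Q (suc k) x ≡ Q k x
  Q-suc-below k = splice-below (M (suc k)) (Q k) (D (suc k))

  Q-suc-above : ∀ k x → M (suc k) ≤ x → Q (suc k) x ≡ D (suc k) x
  Q-suc-above k = splice-above (M (suc k)) (Q k) (D (suc k))

  stable : ∀ {k k'} x → k ≤ k' → x < M k → Q k' x ≡ Q k x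
  stable {k} {zero} x z≤n x<M = refl
  stable {k} {suc k'} x k≤ x<M with m≤n⇒m<n∨m≡n k≤
  ... | inj₁ (s≤s k≤k') =
        trans (Q-suc-below k' x (<-≤-trans x<M (M-mono (≤-trans k≤k' (n≤1+n k')))))
              (stable x k≤k' x<M)
  ... | inj₂ refl = refl

  stage-tail : ∀ {k} k' x → k ≤ k' → M k ≤ x → ∃ λ j → k ≤ j × Q k' x ≡ D j x
  stage-tail zero x k≤ _ = zero , k≤ , refl
  stage-tail {k} (suc k') x k≤ M≤x with M (suc k') ≤? x
  ... | yes M'≤x = suc k' , k≤ , Q-suc-above k' x M'≤x
  ... | no M'≰x with m≤n⇒m<n∨m≡n k≤
  ...   | inj₂ refl = contradiction M≤x M'≰x
  ...   | inj₁ (s≤s k≤k') =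
          let (j , k≤j , eq) = stage-tail k' x k≤k' M≤x
          in j , k≤j , trans (Q-suc-below k' x (≰⇒> M'≰x)) eq

  -- The limit of the stages: bit x is final from stage x+1 on, since x < M (x+1).
  B : Subset
  B x = Q (suc x) x

  B-agrees : ∀ k x → x < M k → B x ≡ Q k x
  B-agrees k x x<M with suc x ≤? k
  ... | yes x<k = sym (stable x x<k (k≤M (suc x)))
  ... | no x≮k = stable x (<⇒≤ (≰⇒> x≮k)) x<M

  -- B shares with stage k its k-th window, so B ∈ U k for every k.
  B∈U : ∀ k → InOpen (U k) B
  B∈U k = L k , subst (U k) (sym same-prefix) Q∈U
    where
    Q∈U : U k (prefix (Q k) (L k))
    Q∈U = proj₂ (Equivalence.to (S⇔U (Q k)) (member (stage k)) k)

    same-prefix : prefix B (L k) ≡ prefix (Q k) (L k)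
    same-prefix = prefix-cong B (Q k) (L k) λ x x<L →
      let x<M = ≤-<-trans (<⇒≤ x<L) (L<M k)
      in trans (B-agrees (suc k) x x<M) (Q-suc-below k x x<M)

  assembled : Assembled D
  assembled = record
    { set = B
    ; from = λ x → let (j , _ , eq) = stage-tail (suc x) x z≤n z≤n in j , eq
    ; tailFrom = λ k → M k , λ x M≤x →
        stage-tail (suc x) x (≤-trans (k≤M k) (≤-trans M≤x (n≤1+n x))) M≤x
    }

  assembled∈S : S B
  assembled∈S = Equivalence.from (S⇔U B) B∈U

module Remainders (A : Subset) (As : ℕ → Subset) where

  Rest : ℕ → Subset
  Rest zero = A
  Rest (suc k) x with As k x
  ... | true = false
  ... | false = Rest k x

  Rest-step : ∀ k x → x ∈ Rest (suc k) → x ∈ Rest k × As k x ≡ false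
  Rest-step k x x∈R with As k x
  ... | false = x∈R , refl
  Rest-step k x () | true

  Rest⊆A : ∀ k → Rest k ⊆ A
  Rest⊆A zero x x∈R = x∈R
  Rest⊆A (suc k) x x∈R = Rest⊆A k x (proj₁ (Rest-step k x x∈R))

  Rest-avoids : ∀ {i} k x → i < k → x ∈ Rest k → ¬ x ∈ As i
  Rest-avoids {i} (suc k) x (s≤s i≤k) x∈R x∈Ai with m≤n⇒m<n∨m≡n i≤k | Rest-step k x x∈R
  ... | inj₁ i<k | x∈R' , _ = Rest-avoids k x i<k x∈R' x∈Ai
  ... | inj₂ refl | _ , x∉Ak with trans (sym x∈Ai) x∉Ak
  ...   | ()

  Rest-covers : ∀ k x → x ∈ A → x ∈ Rest k ⊎ ∃ λ i → i < k × x ∈ As i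
  Rest-covers zero x x∈A = inj₁ x∈A
  Rest-covers (suc k) x x∈A with Rest-covers k x x∈A
  ... | inj₂ (i , i<k , x∈Ai) = inj₂ (i , ≤-trans i<k (n≤1+n k) , x∈Ai)
  ... | inj₁ x∈R with As k x in eq
  ...   | true = inj₂ (k , ≤-refl , eq)
  ...   | false = inj₁ x∈R

  pieces : (k : ℕ) → Fin (suc k) → Subset
  pieces k fzero = Rest k
  pieces k (fsuc i) = As (toℕ i)

  pieces-cover : IsUnion A As → ∀ k → IsUnion A (pieces k)
  pieces-cover A=⋃As k x = mk⇔ to from
    where
    to : x ∈ A → ∃ λ i → x ∈ pieces k i
    to x∈A with Rest-covers k x x∈A
    ... | inj₁ x∈R = fzero , x∈R
    ... | inj₂ (i , i<k , x∈Ai) =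
          fsuc (fromℕ< i<k) , subst (λ j → x ∈ As j) (sym (toℕ-fromℕ< i<k)) x∈Ai
    from : (∃ λ i → x ∈ pieces k i) → x ∈ A
    from (fzero , x∈R) = Rest⊆A k x x∈R
    from (fsuc i , x∈Ai) = Equivalence.from (A=⋃As x) (toℕ i , x∈Ai)

  Rest-large : ∀ {S} → RamseyProperty S → S A → IsUnion A As → ¬ (∃ λ n → S (As n)) →
               ∀ k → S (Rest k)
  Rest-large R A∈S A=⋃As none k with R k A (pieces k) A∈S (pieces-cover A=⋃As k)
  ... | fzero , Rest∈S = Rest∈S
  ... | fsuc i , Ai∈S = ⊥-elim (none (toℕ i , Ai∈S))

  assembled⊆A : (P : Assembled Rest) → Assembled.set P ⊆ A
  assembled⊆A P x x∈P =
    let (j , eq) = Assembled.from P x in Rest⊆A j x (trans (sym eq) x∈P)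

  -- ... and meets each As n only finitely, since its tail comes from Rest j with j > n.
  assembled-almost-disjoint : (P : Assembled Rest) →
                              ∀ n → FiniteIntersection (Assembled.set P) (As n)
  assembled-almost-disjoint P n =
    let (N , tail) = Assembled.tailFrom P (suc n)
    in N , λ x N≤x x∈P x∈An →
      let (j , n<j , eq) = tail x N≤x in Rest-avoids j x n<j (trans (sym eq) x∈P) x∈An

proposition6p6 : ExcludedMiddle 0ℓ → (G : Family) → IsSemifilter G → IsGδ G →
    RamseyProperty G → CountablyRamsey G
proposition6p6 em G SF (U , G⇔U) R A As A∈G A=⋃As with em {∃ λ n → G (As n)}
... | yes some = inj₁ some
... | no none =
  inj₂ (Assembled.set assembled , assembled⊆A assembled , assembled∈S ,
        assembled-almost-disjoint assembled)
  where
  open Remainders A As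
  open Fusion G U G⇔U (splice-member SF) Rest (Rest-large R A∈G A=⋃As none)
    using (assembled; assembled∈S)
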